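{- Let $(F,L,l)$ be an instance of the 2-ASLASAT problem and let $l^*$ be a neutral literal of $(F,L,l)$. Then there is a culprit set of $(F,L\cup\{l^*\},l)$ whose size is at most the size of a smallest culprit set of $(F,L,l)$.
   Context: A literal is a Boolean variable or its negation; $\neg$ denotes negation, and for a set $L$ of literals $\neg L=\{\neg l': l'\in L\}$. $Var(\cdot)$ denotes the set of variables. A 2-CNF formula $F$ is a conjunction of clauses each consisting of exactly two literals (a one-literal clause $(l)$ is written $(l\vee l)$; $(l_1\vee l_2)$ and $(l_2\vee l_1)$ are the same clause), with pairwise distinct clauses; $Clauses(F)$ is its set of clauses and $F\setminus S$ is the formula of clauses of $F$ not in $S$. A set of literals is non-contradictory if it contains no literal and its negation. A satisfying assignment of $F$ is a non-contradictory set $P$ of literals with $Var(P)=Var(F)$ such that each clause of $F$ contains a literal of $P$. $SWRT(F,L)$ means $F$ has a satisfying assignment $P$ with $P\cap \neg L=\emptyset$. An instance of the 2-ASLASAT problem is a triple $(F,L,l)$ with $F$ such a 2-CNF formula, $L$ a non-contradictory set of literals with $SWRT(F,L)$ true, and $l$ a literal with $Var(l)\notin Var(L)$. A culprit set of $(F,L,l)$ is $S\subseteq Clauses(F)$ with $SWRT(F\setminus S,L\cup\{l\})$ true. A walk of $F$ is a nonempty sequence $(C_1,\dots,C_q)$ of (not necessarily distinct) clauses of $F$ where in each entry one literal is designated first and the other second, such that for $i<q$ the second literal of $C_i$ is the negation of the first literal of $C_{i+1}$; it is from the first literal of $C_1$ to the second literal of $C_q$, and from a set $M$ if its first literal lies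 in $M$. A path is a walk whose clauses are pairwise distinct. For a set $M$ of literals and a literal $l_y$, $SepSize(F,M,l_y)$ is the minimum size of a set $SC$ of clauses of $F$ such that $F\setminus SC$ has no path from $M$ to $l_y$. A literal $l^*$ is a neutral literal of $(F,L,l)$ if $(F,L\cup\{l^*\},l)$ is an instance of the 2-ASLASAT problem and $SepSize(F,\neg L,\neg l)=SepSize(F,\neg(L\cup\{l^*\}),\neg l)$. -}

module Defs where

open import Data.Nat using (ℕ; _≤_)
import Data.Nat as ℕ
open import Data.Product using (_×_; _,_; Σ; ∃; ∃-syntax; proj₁; proj₂)
open import Data.Empty using (⊥)
open import Data.Sum using (_⊎_; inj₁; inj₂)
open import Data.List using (List; []; _∷_; map; length; filter; concatMap)
open import Data.List.Membership.Propositional using (_∈_)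
open import Data.List.Relation.Unary.Any using (Any; any?)
open import Data.List.Relation.Unary.All using (All)
open import Data.List.Relation.Unary.AllPairs using (AllPairs)
open import Relation.Binary.PropositionalEquality using (_≡_; refl; cong)
open import Relation.Nullary using (¬_; Dec; yes; no)
open import Relation.Nullary.Decidable using (¬?)
open import Function.Bundles using (_⇔_)

data Literal : Set where
  pos : ℕ → Literal
  neg : ℕ → Literal

var : Literal → ℕ
var (pos x) = x
var (neg x) = x

∼_ : Literal → Literal
∼ pos x = neg x
∼ neg x = pos x

negSet : List Literal → List Literal
negSet = map ∼_

_≟L_ : (a b : Literal) → Dec (a ≡ b)
pos x ≟L pos y with x ℕ.≟ y
... | yes refl = yes refl
... | no x≢y = no λ { refl → x≢y refl }
pos x ≟L neg y = no λ ()
neg x ≟L pos y = no λ ()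
neg x ≟L neg y with x ℕ.≟ y
... | yes refl = yes refl
... | no x≢y = no λ { refl → x≢y refl }

-- Clauses: two literals, unordered ((l ∨ l) encodes a unit clause)

Clause : Set
Clause = Literal × Literal

swap : Clause → Clause
swap (a , b) = (b , a)

_≈c_ : Clause → Clause → Set
c ≈c d = c ≡ d ⊎ swap c ≡ d

_≟C_ : (c d : Clause) → Dec (c ≡ d)
(a , b) ≟C (a' , b') with a ≟L a' | b ≟L b'
... | yes refl | yes refl = yes refl
... | no p | _ = no λ { refl → p refl }
... | yes _ | no q = no λ { refl → q refl }

_≈c?_ : (c d : Clause) → Dec (c ≈c d)
c ≈c? d with c ≟C d | swap c ≟C d
... | yes p | _ = yes (inj₁ p)
... | no _ | yes q = yes (inj₂ q)
... | no p | no q = no λ { (inj₁ e) → p e ; (inj₂ e) → q e }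

_∈c_ : Clause → List Clause → Set
c ∈c Cs = Any (c ≈c_) Cs

_∈c?_ : (c : Clause) → (Cs : List Clause) → Dec (c ∈c Cs)
c ∈c? Cs = any? (c ≈c?_) Cs

Formula : Set
Formula = List Clause

DistinctClauses : List Clause → Set
DistinctClauses = AllPairs (λ c d → ¬ (c ≈c d))

Vars : List Literal → List ℕ
Vars = map var

VarF : Formula → List ℕ
VarF = concatMap (λ { (a , b) → var a ∷ var b ∷ [] })

_∖_ : Formula → List Clause → Formula
F ∖ S = filter (λ c → ¬? (c ∈c? S)) F

_⊆c_ : List Clause → Formula → Set
S ⊆c F = All (λ c → c ∈c F) S

NonContradictory : List Literal → Set
NonContradictory L = ∀ a → a ∈ L → ¬ ((∼ a) ∈ L)

SatAssignment : Formula → List Literal → Set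
SatAssignment F P =
  NonContradictory P ×
  (∀ x → (x ∈ Vars P) ⇔ (x ∈ VarF F)) ×
  All (λ { (a , b) → a ∈ P ⊎ b ∈ P }) F

SWRT : Formula → List Literal → Set
SWRT F L = ∃[ P ] (SatAssignment F P × (∀ a → a ∈ P → ¬ (a ∈ negSet L)))

Instance : Formula → List Literal → Literal → Set
Instance F L l = DistinctClauses F × NonContradictory L × SWRT F L × ¬ (var l ∈ Vars L)

-- S is a culprit set of (F, L, l); S is a set (no repeated clause), so |S| = length S
Culprit : Formula → List Literal → Literal → List Clause → Set
Culprit F L l S = S ⊆c F × DistinctClauses S × SWRT (F ∖ S) (l ∷ L)

MinCulpritSize : Formula → List Literal → Literal → ℕ → Set
MinCulpritSize F L l k =
  (∃[ S ] (Culprit F L l S × length S ≡ k)) ×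
  (∀ S → Culprit F L l S → k ≤ length S)

-- an entry of a walk: a clause of F with a chosen orientation (first , second)
IsEntry : Formula → Clause → Set
IsEntry F c = c ∈c F

data Chain : List Clause → Set where
  one  : ∀ {c} → Chain (c ∷ [])
  more : ∀ {a b c d} {cs} → b ≡ ∼ c → Chain ((c , d) ∷ cs) → Chain ((a , b) ∷ (c , d) ∷ cs)

lastSecond : Clause → List Clause → Literal
lastSecond (a , b) [] = b
lastSecond _ (c ∷ cs) = lastSecond c cs

Walk : Formula → Literal → Literal → List Clause → Set
Walk F u v [] = ⊥
Walk F u v (c ∷ cs) =
  All (IsEntry F) (c ∷ cs) × Chain (c ∷ cs) × proj₁ c ≡ u × lastSecond c cs ≡ v

Path : Formula → Literal → Literal → List Clause → Set
Path F u v W = Walk F u v W × DistinctClauses W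

HasPathFrom : Formula → List Literal → Literal → Set
HasPathFrom F M v = ∃[ u ] ∃[ W ] (u ∈ M × Path F u v W)

Separator : Formula → List Literal → Literal → List Clause → Set
Separator F M v SC = SC ⊆c F × DistinctClauses SC × ¬ HasPathFrom (F ∖ SC) M v

SepSizeIs : Formula → List Literal → Literal → ℕ → Set
SepSizeIs F M v k =
  (∃[ SC ] (Separator F M v SC × length SC ≡ k)) ×
  (∀ SC → Separator F M v SC → k ≤ length SC)

Neutral : Formula → List Literal → Literal → Literal → Set
Neutral F L l l* =
  Instance F (l* ∷ L) l ×
  ∃[ k ] (SepSizeIs F (negSet L) (∼ l) k × SepSizeIs F (negSet (l* ∷ L)) (∼ l) k)

module Submission where

-- Let M = l* ∷ L.  Take a minimum separator SC of ¬M from ¬l (of size SepSize(F, ¬L, ¬l),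
-- by neutrality), a smallest culprit set S of (F, L, l) with its satisfying assignment P,
-- and a satisfying assignment P₀ of F avoiding ¬M.  A literal is "forced" if it lies in M
-- or is reachable from ¬M by a path of F ∖ SC; forced literals are true under P₀, so no
-- literal is forced together with its negation, and forcing propagates along F ∖ SC.
-- Extend P to a total assignment agreeing with l ∷ L and override it by making every
-- forced literal true; the override agrees with l ∷ M, so the clauses it violates form a
-- culprit set of (F, M, l).  Classifying the clauses of F against the forced set, those
-- leaving the forced set lie in SC, while those leaving "forced and true" separate ¬L
-- from ¬l; comparing the two counts bounds the new culprit set by |S|.

open import Defs
open import Data.Nat using (ℕ; _≤_; zero; suc; z≤n; s≤s; _+_)
open import Data.Nat.Properties
  using (≤-trans; m≤m+n; m≤n+m; +-mono-≤; +-monoˡ-≤; +-comm; +-cancelˡ-≤; +-commutativeSemigroup; module ≤-Reasoning)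
open import Algebra.Properties.CommutativeSemigroup +-commutativeSemigroup using (interchange)
open import Data.List using (List; []; _∷_; length; filter; map; _++_; concatMap)
open import Data.List.Membership.Propositional using (_∈_; find; lose)
open import Data.List.Membership.Propositional.Properties
  using (∈-map⁺; ∈-map⁻; ∈-filter⁺; ∈-filter⁻; ∈-++⁺ˡ; ∈-++⁺ʳ; ∈-concatMap⁺)
open import Data.List.Membership.DecPropositional _≟L_ using (_∈?_)
open import Data.List.Relation.Unary.Any as Any using (here; there; any?)
open import Data.List.Relation.Unary.All as All using (All; []; _∷_; all?)
open import Data.List.Relation.Unary.All.Properties using (¬Any⇒All¬; ++⁻ˡ) renaming (++⁺ to All-++⁺)
open import Data.List.Relation.Unary.AllPairs using (AllPairs; []; _∷_; allPairs?)
open import Data.List.Relation.Unary.AllPairs.Properties using (filter⁺)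
open import Data.Product using (_×_; _,_; Σ; ∃-syntax; proj₁; proj₂)
open import Data.Sum using (_⊎_; inj₁; inj₂)
open import Data.Empty using (⊥; ⊥-elim)
open import Function.Bundles using (mk⇔)
open import Level using (0ℓ)
open import Relation.Binary.PropositionalEquality using (_≡_; _≢_; refl; sym; trans; cong; cong₂; subst)
open import Relation.Nullary using (¬_; Dec; yes; no)
open import Relation.Nullary.Decidable using (_×-dec_; _⊎-dec_; ¬?; map′)
open import Relation.Unary using (Pred; Decidable)

∼-involutive : ∀ x → ∼ (∼ x) ≡ x
∼-involutive (pos _) = refl
∼-involutive (neg _) = refl

var-∼ : ∀ x → var (∼ x) ≡ var x
var-∼ (pos _) = refl
var-∼ (neg _) = refl

x≢∼x : ∀ x → x ≢ ∼ x
x≢∼x (pos _) ()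
x≢∼x (neg _) ()

fresh-∷-nc : ∀ {l K} → NonContradictory K → ¬ (var l ∈ Vars K) → NonContradictory (l ∷ K)
fresh-∷-nc {l} _ _ .l (here refl) (here l≡∼l) = x≢∼x l (sym l≡∼l)
fresh-∷-nc {l} _ l∉K .l (here refl) (there ∼l∈K) =
  l∉K (subst (_∈ Vars _) (var-∼ l) (∈-map⁺ var ∼l∈K))
fresh-∷-nc {l} _ l∉K x (there x∈K) (here ∼x≡l) =
  l∉K (subst (_∈ Vars _) (trans (sym (var-∼ x)) (cong var ∼x≡l)) (∈-map⁺ var x∈K))
fresh-∷-nc K-nc _ x (there x∈K) (there ∼x∈K) = K-nc x x∈K ∼x∈K

≈c-sym : ∀ {c d} → c ≈c d → d ≈c c
≈c-sym (inj₁ refl) = inj₁ refl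
≈c-sym (inj₂ refl) = inj₂ refl

≈c-trans : ∀ {c d e} → c ≈c d → d ≈c e → c ≈c e
≈c-trans (inj₁ refl) d≈e = d≈e
≈c-trans (inj₂ refl) (inj₁ refl) = inj₂ refl
≈c-trans (inj₂ refl) (inj₂ refl) = inj₁ refl

∈⇒∈c : ∀ {c G} → c ∈ G → c ∈c G
∈⇒∈c c∈G = lose c∈G (inj₁ refl)

swap-∈c : ∀ {c G} → c ∈c G → swap c ∈c G
swap-∈c = Any.map (≈c-trans (inj₂ refl))

∖-member⁻ : ∀ {e} F S → e ∈c (F ∖ S) → e ∈c F × ¬ (e ∈c S)
∖-member⁻ F S e∈ with find e∈
... | d , d∈ , e≈d with ∈-filter⁻ (λ c → ¬? (c ∈c? S)) {xs = F} d∈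
...   | d∈F , d∉S = lose d∈F e≈d , λ e∈S → d∉S (Any.map (≈c-trans (≈c-sym e≈d)) e∈S)

∖-member⁺ : ∀ {c} F S → c ∈ F → ¬ (c ∈c S) → c ∈c (F ∖ S)
∖-member⁺ F S c∈F c∉S = ∈⇒∈c (∈-filter⁺ (λ c → ¬? (c ∈c? S)) {xs = F} c∈F c∉S)

Satisfies : List Literal → Formula → Set
Satisfies P G = All (λ c → proj₁ c ∈ P ⊎ proj₂ c ∈ P) G

satisfies-∈c : ∀ {P G e} → Satisfies P G → e ∈c G → proj₁ e ∈ P ⊎ proj₂ e ∈ P
satisfies-∈c sat e∈ with find e∈
... | d , d∈ , inj₁ refl = All.lookup sat d∈
... | d , d∈ , inj₂ refl with All.lookup sat d∈
...   | inj₁ t = inj₂ t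
...   | inj₂ t = inj₁ t

remove : ∀ {a} B → a ∈c B →
  Σ (List Clause) λ B' → length B ≡ suc (length B') × (∀ c → c ∈c B → ¬ (c ≈c a) → c ∈c B')
remove (b ∷ B) (here a≈b) =
  B , refl , λ { c (here c≈b) c≉a → ⊥-elim (c≉a (≈c-trans c≈b (≈c-sym a≈b)))
               ; c (there c∈B) _ → c∈B }
remove (b ∷ B) (there a∈B) with remove B a∈B
... | B' , len , keep =
  b ∷ B' , cong suc len , λ { c (here c≈b) _ → here c≈b
                             ; c (there c∈B) c≉a → there (keep c c∈B c≉a) }

distinct-length-≤ : ∀ A B → DistinctClauses A → All (_∈c B) A → length A ≤ length B
distinct-length-≤ [] B _ _ = z≤n
distinct-length-≤ (a ∷ A) B (a≉A ∷ A-distinct) (a∈B ∷ A⊆B) with remove B a∈B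
... | B' , len , keep = subst (suc (length A) ≤_) (sym len) (s≤s (distinct-length-≤ A B' A-distinct A⊆B'))
  where
  A⊆B' : All (_∈c B') A
  A⊆B' = All.tabulate λ {c} c∈A → keep c (All.lookup A⊆B c∈A) λ c≈a → All.lookup a≉A c∈A (≈c-sym c≈a)

module Count {A : Set} where

  count : {P : Pred A 0ℓ} → Decidable P → List A → ℕ
  count P? xs = length (filter P? xs)

  indicator : {X : Set} → Dec X → ℕ
  indicator (yes _) = 1
  indicator (no _) = 0

  indicator-yes : {X : Set} (X? : Dec X) → X → 1 ≤ indicator X?
  indicator-yes (yes _) _ = s≤s z≤n
  indicator-yes (no ¬x) x = ⊥-elim (¬x x)

  count-∷ : {P : Pred A 0ℓ} (P? : Decidable P) → ∀ x xs → count P? (x ∷ xs) ≡ indicator (P? x) + count P? xs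
  count-∷ P? x xs with P? x
  ... | yes _ = refl
  ... | no _ = refl

  module _ {P Q R : Pred A 0ℓ} (P? : Decidable P) (Q? : Decidable Q) (R? : Decidable R) where
    open ≤-Reasoning

    count-union : ∀ xs → (∀ x → x ∈ xs → P x → Q x ⊎ R x) → count P? xs ≤ count Q? xs + count R? xs
    count-union [] _ = z≤n
    count-union (x ∷ xs) cover = begin
      count P? (x ∷ xs)                                                  ≡⟨ count-∷ P? x xs ⟩
      indicator (P? x) + count P? xs                                     ≤⟨ +-mono-≤ (pointwise (P? x)) IH ⟩
      (indicator (Q? x) + indicator (R? x)) + (count Q? xs + count R? xs) ≡⟨ interchange (indicator (Q? x)) (indicator (R? x)) (count Q? xs) (count R? xs) ⟩
      (indicator (Q? x) + count Q? xs) + (indicator (R? x) + count R? xs) ≡⟨ sym (cong₂ _+_ (count-∷ Q? x xs) (count-∷ R? x xs)) ⟩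
      count Q? (x ∷ xs) + count R? (x ∷ xs)                              ∎
      where
      IH = count-union xs (λ y y∈ → cover y (there y∈))
      pointwise : (p? : Dec (P x)) → indicator p? ≤ indicator (Q? x) + indicator (R? x)
      pointwise (no _) = z≤n
      pointwise (yes p) with cover x (here refl) p
      ... | inj₁ q = ≤-trans (indicator-yes (Q? x) q) (m≤m+n _ _)
      ... | inj₂ r = ≤-trans (indicator-yes (R? x) r) (m≤n+m _ _)

    count-disjoint : ∀ xs → (∀ x → x ∈ xs → P x → ¬ Q x) → (∀ x → x ∈ xs → P x ⊎ Q x → R x) →
                     count P? xs + count Q? xs ≤ count R? xs
    count-disjoint [] _ _ = z≤n
    count-disjoint (x ∷ xs) disjoint cover = begin
      count P? (x ∷ xs) + count Q? (x ∷ xs)                              ≡⟨ cong₂ _+_ (count-∷ P? x xs) (count-∷ Q? x xs) ⟩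
      (indicator (P? x) + count P? xs) + (indicator (Q? x) + count Q? xs) ≡⟨ interchange (indicator (P? x)) (count P? xs) (indicator (Q? x)) (count Q? xs) ⟩
      (indicator (P? x) + indicator (Q? x)) + (count P? xs + count Q? xs) ≤⟨ +-mono-≤ (pointwise (P? x) (Q? x)) IH ⟩
      indicator (R? x) + count R? xs                                     ≡⟨ sym (count-∷ R? x xs) ⟩
      count R? (x ∷ xs)                                                  ∎
      where
      IH = count-disjoint xs (λ y y∈ → disjoint y (there y∈)) (λ y y∈ → cover y (there y∈))
      pointwise : (p? : Dec (P x)) (q? : Dec (Q x)) → indicator p? + indicator q? ≤ indicator (R? x)
      pointwise (yes p) (yes q) = ⊥-elim (disjoint x (here refl) p q)
      pointwise (yes p) (no _) = indicator-yes (R? x) (cover x (here refl) (inj₁ p))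
      pointwise (no _) (yes q) = indicator-yes (R? x) (cover x (here refl) (inj₂ q))
      pointwise (no _) (no _) = z≤n

open Count

count-≤-length : ∀ {P : Pred Clause 0ℓ} (P? : Decidable P) {F B} → DistinctClauses F →
                 (∀ c → c ∈ F → P c → c ∈c B) → count P? F ≤ length B
count-≤-length P? {F} {B} F-distinct P⊆B =
  distinct-length-≤ _ B (filter⁺ P? F-distinct)
    (All.tabulate λ c∈ → let (c∈F , p) = ∈-filter⁻ P? c∈ in P⊆B _ c∈F p)

lastSecond-snoc : ∀ c cs e → lastSecond c (cs ++ e ∷ []) ≡ proj₂ e
lastSecond-snoc c [] e = refl
lastSecond-snoc c (c' ∷ cs) e = lastSecond-snoc c' cs e

chain-snoc : ∀ c cs e → Chain (c ∷ cs) → lastSecond c cs ≡ ∼ proj₁ e → Chain (c ∷ cs ++ e ∷ [])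
chain-snoc c [] e one joint = more joint one
chain-snoc c (c' ∷ cs) e (more joint' ch) joint = more joint' (chain-snoc c' cs e ch joint)

last-entry : ∀ c cs → Σ Clause λ w → w ∈ (c ∷ cs) × proj₂ w ≡ lastSecond c cs
last-entry c [] = c , here refl , refl
last-entry c (c' ∷ cs) with last-entry c' cs
... | w , w∈ , w₂ = w , there w∈ , w₂

chain-prefix : ∀ c cs e → Chain (c ∷ cs) → e ∈ (c ∷ cs) →
  Σ (List Clause) λ ys → Σ (List Clause) λ zs → cs ≡ ys ++ zs × Chain (c ∷ ys) × lastSecond c ys ≡ proj₂ e
chain-prefix c cs .c ch (here refl) = [] , cs , refl , one , refl
chain-prefix c (c' ∷ cs) e (more joint ch) (there e∈) with chain-prefix c' cs e ch e∈
... | ys , zs , refl , ch' , last = c' ∷ ys , zs , refl , more joint ch' , last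

allPairs-prefix : ∀ {R : Clause → Clause → Set} xs {ys} → AllPairs R (xs ++ ys) → AllPairs R xs
allPairs-prefix [] _ = []
allPairs-prefix (x ∷ xs) (x-ok ∷ rest) = ++⁻ˡ xs x-ok ∷ allPairs-prefix xs rest

allPairs-snoc : ∀ {R : Clause → Clause → Set} {xs e} → AllPairs R xs → All (λ x → R x e) xs → AllPairs R (xs ++ e ∷ [])
allPairs-snoc [] [] = [] ∷ []
allPairs-snoc (x-ok ∷ rest) (r ∷ rs) = All-++⁺ x-ok (r ∷ []) ∷ allPairs-snoc rest rs

path-snoc : ∀ {G u c cs e} → Path G u (∼ proj₁ e) (c ∷ cs) → e ∈c G → ¬ (e ∈c (c ∷ cs)) →
            Path G u (proj₂ e) (c ∷ cs ++ e ∷ [])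
path-snoc {c = c} {cs} {e} ((entries , ch , first , last) , distinct) e∈G e∉ =
  (All-++⁺ entries (e∈G ∷ []) , chain-snoc c cs e ch last , first , lastSecond-snoc c cs e) ,
  allPairs-snoc distinct (All.map (λ e≉x x≈e → e≉x (≈c-sym x≈e)) (¬Any⇒All¬ _ e∉))

path-prefix : ∀ {G u v c cs e} → Path G u v (c ∷ cs) → e ∈ (c ∷ cs) → ∃[ W ] Path G u (proj₂ e) W
path-prefix {c = c} {cs} {e} ((entries , ch , first , _) , distinct) e∈ with chain-prefix c cs e ch e∈
... | ys , zs , refl , ch' , last =
  c ∷ ys , (++⁻ˡ (c ∷ ys) entries , ch' , first , last) , allPairs-prefix (c ∷ ys) distinct

path-entries : ∀ {G u v} W → Path G u v W → All (_∈c G) W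
path-entries [] ((), _)
path-entries (_ ∷ _) ((entries , _) , _) = entries

listsUpTo : ℕ → List Clause → List (List Clause)
listsUpTo zero X = [] ∷ []
listsUpTo (suc n) X = [] ∷ concatMap (λ x → map (x ∷_) (listsUpTo n X)) X

listsUpTo-complete : ∀ n X W → All (_∈ X) W → length W ≤ n → W ∈ listsUpTo n X
listsUpTo-complete zero X [] _ _ = here refl
listsUpTo-complete (suc n) X [] _ _ = here refl
listsUpTo-complete (suc n) X (w ∷ W) (w∈X ∷ W⊆X) (s≤s len) =
  there (∈-concatMap⁺ (λ x → map (x ∷_) (listsUpTo n X))
          (lose w∈X (∈-map⁺ (w ∷_) (listsUpTo-complete n X W W⊆X len))))

orientations : Formula → List Clause
orientations G = G ++ map swap G

∈c⇒∈-orientations : ∀ {e} G → e ∈c G → e ∈ orientations G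
∈c⇒∈-orientations G e∈ with find e∈
... | d , d∈ , inj₁ refl = ∈-++⁺ˡ d∈
... | d , d∈ , inj₂ refl = ∈-++⁺ʳ G (∈-map⁺ swap d∈)

chain? : ∀ W → Dec (Chain W)
chain? [] = no λ ()
chain? (c ∷ []) = yes one
chain? ((a , b) ∷ (c , d) ∷ cs) with b ≟L (∼ c) | chain? ((c , d) ∷ cs)
... | yes joint | yes ch = yes (more joint ch)
... | no ¬joint | _ = no λ { (more joint _) → ¬joint joint }
... | yes _ | no ¬ch = no λ { (more _ ch) → ¬ch ch }

PathFromTo : Formula → List Literal → Literal → List Clause → Set
PathFromTo G M x W = ∃[ u ] (u ∈ M × Path G u x W)

pathFromTo? : ∀ G M x W → Dec (PathFromTo G M x W)
pathFromTo? G M x [] = no λ { (_ , _ , (() , _)) }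
pathFromTo? G M x (c ∷ cs) =
  map′ (λ { (u∈ , entries , ch , last , distinct) → proj₁ c , u∈ , (entries , ch , refl , last) , distinct })
       (λ { (_ , u∈ , (entries , ch , refl , last) , distinct) → u∈ , entries , ch , last , distinct })
       (proj₁ c ∈? M ×-dec all? (_∈c? G) (c ∷ cs) ×-dec chain? (c ∷ cs) ×-dec
        lastSecond c cs ≟L x ×-dec allPairs? (λ d e → ¬? (d ≈c? e)) (c ∷ cs))

-- Reachability is decidable: a path has distinct clauses of G, so it is among the
-- finitely many lists of length at most |G| over the orientations of G.
hasPathFrom? : ∀ G M x → Dec (HasPathFrom G M x)
hasPathFrom? G M x with any? (pathFromTo? G M x) (listsUpTo (length G) (orientations G))
... | yes found with find found
...   | W , _ , (u , u∈ , path) = yes (u , W , u∈ , path)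
hasPathFrom? G M x | no none = no λ { (u , W , u∈ , path) → none (lose (candidate W path) (u , u∈ , path)) }
  where
  candidate : ∀ W {u} → Path G u x W → W ∈ listsUpTo (length G) (orientations G)
  candidate W path =
    listsUpTo-complete (length G) (orientations G) W
      (All.map (∈c⇒∈-orientations G) (path-entries W path))
      (distinct-length-≤ W G (proj₂ path) (path-entries W path))

module Forcing
  (F : Formula) (M P₀ : List Literal)
  (P₀-nc : NonContradictory P₀) (P₀-sat : Satisfies P₀ F) (P₀-avoids : ∀ a → a ∈ P₀ → ¬ (a ∈ negSet M))
  (SC : List Clause)
  where

  Residual : Formula
  Residual = F ∖ SC

  Reached : Literal → Set
  Reached = HasPathFrom Residual (negSet M)

  Forced : Literal → Set
  Forced x = x ∈ M ⊎ Reached x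

  forced? : ∀ x → Dec (Forced x)
  forced? x = (x ∈? M) ⊎-dec hasPathFrom? Residual (negSet M) x

  second-true : ∀ {e} → e ∈c F → ¬ (proj₁ e ∈ P₀) → proj₂ e ∈ P₀
  second-true e∈F first-false with satisfies-∈c P₀-sat e∈F
  ... | inj₁ t = ⊥-elim (first-false t)
  ... | inj₂ t = t

  walk-true : ∀ c cs → All (_∈c F) (c ∷ cs) → Chain (c ∷ cs) → ¬ (proj₁ c ∈ P₀) →
              All (λ w → proj₂ w ∈ P₀) (c ∷ cs)
  walk-true c [] (c∈F ∷ []) one first-false = second-true c∈F first-false ∷ []
  walk-true c (c' ∷ cs) (c∈F ∷ rest) (more joint ch) first-false =
    t ∷ walk-true c' cs rest ch (λ t' → P₀-nc _ t' (subst (_∈ P₀) joint t))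
    where t = second-true c∈F first-false

  -- Walks of F ∖ SC from ¬M start at a false literal, so every reached literal is true.
  residual-walk-true : ∀ {u v c cs} → u ∈ negSet M → Walk Residual u v (c ∷ cs) →
                       All (λ w → proj₂ w ∈ P₀) (c ∷ cs)
  residual-walk-true {u} u∈ (entries , ch , refl , _) =
    walk-true _ _ (All.map (λ e∈ → proj₁ (∖-member⁻ F SC e∈)) entries) ch (λ t → P₀-avoids u t u∈)

  reached-true : ∀ {x} → Reached x → x ∈ P₀
  reached-true (_ , [] , _ , (() , _))
  reached-true (_ , c ∷ cs , u∈ , (walk@(_ , _ , _ , last) , _)) with last-entry c cs
  ... | w , w∈ , w₂ = subst (_∈ P₀) (trans w₂ last) (All.lookup (residual-walk-true u∈ walk) w∈)

  forced-not-false : ∀ {x} → Forced x → ¬ (∼ x ∈ P₀)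
  forced-not-false {x} (inj₁ x∈M) f = P₀-avoids (∼ x) f (∈-map⁺ ∼_ x∈M)
  forced-not-false {x} (inj₂ r) f = P₀-nc x (reached-true r) f

  negation-forced-not-true : ∀ {x} → Forced (∼ x) → ¬ (x ∈ P₀)
  negation-forced-not-true {x} r t = forced-not-false r (subst (_∈ P₀) (sym (∼-involutive x)) t)

  forced-consistent : NonContradictory M → ∀ {x} → Forced x → ¬ Forced (∼ x)
  forced-consistent _ r (inj₂ r') = forced-not-false r (reached-true r')
  forced-consistent _ (inj₂ r) (inj₁ ∼x∈M) = negation-forced-not-true (inj₁ ∼x∈M) (reached-true r)
  forced-consistent M-nc {x} (inj₁ x∈M) (inj₁ ∼x∈M) = M-nc x x∈M ∼x∈M

  clause-not-refuted : ∀ {e} → e ∈c F → Forced (∼ proj₁ e) → ¬ Forced (∼ proj₂ e)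
  clause-not-refuted e∈F r₁ r₂ with satisfies-∈c P₀-sat e∈F
  ... | inj₁ t = negation-forced-not-true r₁ t
  ... | inj₂ t = negation-forced-not-true r₂ t

  forced-closed : ∀ {e} → e ∈c Residual → Forced (∼ proj₁ e) → Forced (proj₂ e)
  forced-closed {e} e∈ (inj₁ ∼a∈M) =
    inj₂ (proj₁ e , e ∷ [] , subst (_∈ negSet M) (∼-involutive (proj₁ e)) (∈-map⁺ ∼_ ∼a∈M) ,
          ((e∈ ∷ []) , one , refl , refl) , ([] ∷ []))
  forced-closed e∈ (inj₂ (_ , [] , _ , (() , _)))
  forced-closed {e} e∈ r@(inj₂ (u , c ∷ cs , u∈ , path)) with e ∈c? (c ∷ cs)
  ... | no e∉ = inj₂ (u , _ , u∈ , path-snoc path e∈ e∉)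
  ... | yes e∈path with find e∈path
  ...   | d , d∈ , inj₁ refl = inj₂ (u , proj₁ (path-prefix path d∈) , u∈ , proj₂ (path-prefix path d∈))
  ...   | d , d∈ , inj₂ refl =
    ⊥-elim (negation-forced-not-true r (All.lookup (residual-walk-true u∈ (proj₁ path)) d∈))

  separated-not-forced : ∀ {l} → ¬ (var l ∈ Vars M) → ¬ HasPathFrom Residual (negSet M) (∼ l) → ¬ Forced (∼ l)
  separated-not-forced {l} l∉M _ (inj₁ ∼l∈M) = l∉M (subst (_∈ Vars M) (var-∼ l) (∈-map⁺ var ∼l∈M))
  separated-not-forced _ separates (inj₂ r) = separates r

-- A total assignment is a function choosing a literal for every variable; x holds
-- under f when f chooses x for its variable.
Holds : (ℕ → Literal) → Literal → Set
Holds f x = f (var x) ≡ x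

holds? : ∀ f x → Dec (Holds f x)
holds? f x = f (var x) ≟L x

holds-∼ : ∀ f x → Holds f (∼ x) → ¬ Holds f x
holds-∼ f x ∼x-holds x-holds = x≢∼x x (trans (sym x-holds) (trans (cong f (sym (var-∼ x))) ∼x-holds))

Violated : (ℕ → Literal) → Clause → Set
Violated f (a , b) = ¬ Holds f a × ¬ Holds f b

violated? : ∀ f c → Dec (Violated f c)
violated? f (a , b) = ¬? (holds? f a) ×-dec ¬? (holds? f b)

module Extension
  (P K : List Literal) (P-nc : NonContradictory P) (K-nc : NonContradictory K)
  (P-avoids : ∀ a → a ∈ P → ¬ (a ∈ negSet K))
  where

  extend : ℕ → Literal
  extend z with pos z ∈? P | neg z ∈? P | neg z ∈? K
  ... | yes _ | _ | _ = pos z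
  ... | no _ | yes _ | _ = neg z
  ... | no _ | no _ | yes _ = neg z
  ... | no _ | no _ | no _ = pos z

  extend-var : ∀ z → var (extend z) ≡ z
  extend-var z with pos z ∈? P | neg z ∈? P | neg z ∈? K
  ... | yes _ | _ | _ = refl
  ... | no _ | yes _ | _ = refl
  ... | no _ | no _ | yes _ = refl
  ... | no _ | no _ | no _ = refl

  extend-P : ∀ a → a ∈ P → Holds extend a
  extend-P (pos z) a∈ with pos z ∈? P | neg z ∈? P | neg z ∈? K
  ... | yes _ | _ | _ = refl
  ... | no a∉ | _ | _ = ⊥-elim (a∉ a∈)
  extend-P (neg z) a∈ with pos z ∈? P | neg z ∈? P | neg z ∈? K
  ... | yes pos∈ | _ | _ = ⊥-elim (P-nc (pos z) pos∈ a∈)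
  ... | no _ | yes _ | _ = refl
  ... | no _ | no a∉ | _ = ⊥-elim (a∉ a∈)

  extend-K : ∀ b → b ∈ K → Holds extend b
  extend-K (pos z) b∈ with pos z ∈? P | neg z ∈? P | neg z ∈? K
  ... | yes _ | _ | _ = refl
  ... | no _ | yes neg∈ | _ = ⊥-elim (P-avoids (neg z) neg∈ (∈-map⁺ ∼_ b∈))
  ... | no _ | no _ | yes neg∈K = ⊥-elim (K-nc (pos z) b∈ neg∈K)
  ... | no _ | no _ | no _ = refl
  extend-K (neg z) b∈ with pos z ∈? P | neg z ∈? P | neg z ∈? K
  ... | yes pos∈ | _ | _ = ⊥-elim (P-avoids (pos z) pos∈ (∈-map⁺ ∼_ b∈))
  ... | no _ | yes _ | _ = refl
  ... | no _ | no _ | yes _ = refl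
  ... | no _ | no _ | no b∉ = ⊥-elim (b∉ b∈)

module Override
  (Forced : Literal → Set) (forced? : ∀ x → Dec (Forced x))
  (forced-consistent : ∀ {x} → Forced x → ¬ Forced (∼ x))
  (base : ℕ → Literal) (base-var : ∀ z → var (base z) ≡ z)
  where

  override : ℕ → Literal
  override z with forced? (pos z) | forced? (neg z)
  ... | yes _ | _ = pos z
  ... | no _ | yes _ = neg z
  ... | no _ | no _ = base z

  override-var : ∀ z → var (override z) ≡ z
  override-var z with forced? (pos z) | forced? (neg z)
  ... | yes _ | _ = refl
  ... | no _ | yes _ = refl
  ... | no _ | no _ = base-var z

  override-forced : ∀ x → Forced x → Holds override x
  override-forced (pos z) r with forced? (pos z) | forced? (neg z)
  ... | yes _ | _ = refl
  ... | no ¬r | _ = ⊥-elim (¬r r)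
  override-forced (neg z) r with forced? (pos z) | forced? (neg z)
  ... | yes r' | _ = ⊥-elim (forced-consistent r' r)
  ... | no _ | yes _ = refl
  ... | no _ | no ¬r = ⊥-elim (¬r r)

  override-free : ∀ x → ¬ Forced x → ¬ Forced (∼ x) → override (var x) ≡ base (var x)
  override-free (pos z) ¬r ¬r' with forced? (pos z) | forced? (neg z)
  ... | yes r | _ = ⊥-elim (¬r r)
  ... | no _ | yes r' = ⊥-elim (¬r' r')
  ... | no _ | no _ = refl
  override-free (neg z) ¬r ¬r' with forced? (pos z) | forced? (neg z)
  ... | yes r' | _ = ⊥-elim (¬r' r')
  ... | no _ | yes r = ⊥-elim (¬r r)
  ... | no _ | no _ = refl

-- The clauses violated by a total assignment agreeing with l ∷ L form a culprit set:
-- restricted to the remaining variables, the assignment satisfies the remaining clauses.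
module Restriction (f : ℕ → Literal) (f-var : ∀ z → var (f z) ≡ z) where

  image-holds : ∀ {a vs} → a ∈ map f vs → Holds f a
  image-holds a∈ with ∈-map⁻ f a∈
  ... | z , _ , refl = cong f (f-var z)

  vars-image : ∀ vs → Vars (map f vs) ≡ vs
  vars-image [] = refl
  vars-image (z ∷ vs) = cong₂ _∷_ (f-var z) (vars-image vs)

  var₁∈ : ∀ {c} G → c ∈ G → var (proj₁ c) ∈ VarF G
  var₁∈ (_ ∷ G) (here refl) = here refl
  var₁∈ (_ ∷ G) (there c∈) = there (there (var₁∈ G c∈))

  var₂∈ : ∀ {c} G → c ∈ G → var (proj₂ c) ∈ VarF G
  var₂∈ (_ ∷ G) (here refl) = there (here refl)
  var₂∈ (_ ∷ G) (there c∈) = there (there (var₂∈ G c∈))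

  holding-∈-image : ∀ {x} G → var x ∈ VarF G → Holds f x → x ∈ map f (VarF G)
  holding-∈-image G v∈ h = subst (_∈ map f (VarF G)) h (∈-map⁺ f v∈)

  restriction-satisfies : ∀ G → All (λ c → Holds f (proj₁ c) ⊎ Holds f (proj₂ c)) G →
                          SatAssignment G (map f (VarF G))
  restriction-satisfies G holds =
    (λ a a∈ ∼a∈ → holds-∼ f a (image-holds ∼a∈) (image-holds a∈)) ,
    (λ x → mk⇔ (subst (x ∈_) (vars-image _)) (subst (x ∈_) (sym (vars-image _)))) ,
    All.tabulate clause-satisfied
    where
    clause-satisfied : ∀ {c} → c ∈ G → proj₁ c ∈ map f (VarF G) ⊎ proj₂ c ∈ map f (VarF G)
    clause-satisfied c∈ with All.lookup holds c∈
    ... | inj₁ h = inj₁ (holding-∈-image G (var₁∈ G c∈) h)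
    ... | inj₂ h = inj₂ (holding-∈-image G (var₂∈ G c∈) h)

  violated-culprit : ∀ F L l → DistinctClauses F → (∀ b → b ∈ l ∷ L → Holds f b) →
                     Culprit F L l (filter (violated? f) F)
  violated-culprit F L l F-distinct agrees =
    All.tabulate (λ c∈ → ∈⇒∈c (proj₁ (∈-filter⁻ (violated? f) c∈))) ,
    filter⁺ (violated? f) F-distinct ,
    (map f (VarF Rest) , restriction-satisfies Rest (All.tabulate rest-holds) , avoids)
    where
    Rest = F ∖ filter (violated? f) F
    rest-holds : ∀ {c} → c ∈ Rest → Holds f (proj₁ c) ⊎ Holds f (proj₂ c)
    rest-holds {c} c∈ with holds? f (proj₁ c) | holds? f (proj₂ c)
    ... | yes h | _ = inj₁ h
    ... | no _ | yes h = inj₂ h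
    ... | no ¬h₁ | no ¬h₂ =
      ⊥-elim (proj₂ (∖-member⁻ F _ (∈⇒∈c c∈))
        (∈⇒∈c (∈-filter⁺ (violated? f) (proj₁ (∈-filter⁻ (λ c → ¬? (c ∈c? _)) {xs = F} c∈)) (¬h₁ , ¬h₂))))
    avoids : ∀ a → a ∈ map f (VarF Rest) → ¬ (a ∈ negSet (l ∷ L))
    avoids a a∈ ∼b∈ with ∈-map⁻ ∼_ ∼b∈
    ... | b , b∈ , refl = holds-∼ f b (image-holds a∈) (agrees b b∈)

module Exchange
  (F : Formula) (L : List Literal) (l l* : Literal)
  (F-distinct : DistinctClauses F) (L-nc : NonContradictory L) (l∉L : ¬ (var l ∈ Vars L))
  (M-nc : NonContradictory (l* ∷ L)) (l∉M : ¬ (var l ∈ Vars (l* ∷ L)))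
  (P₀ : List Literal) (P₀-nc : NonContradictory P₀) (P₀-sat : Satisfies P₀ F)
  (P₀-avoids : ∀ a → a ∈ P₀ → ¬ (a ∈ negSet (l* ∷ L)))
  (SC : List Clause) (SC-separates : ¬ HasPathFrom (F ∖ SC) (negSet (l* ∷ L)) (∼ l))
  (S : List Clause) (P : List Literal) (P-nc : NonContradictory P) (P-sat : Satisfies P (F ∖ S))
  (P-avoids : ∀ a → a ∈ P → ¬ (a ∈ negSet (l ∷ L)))
  where

  open Forcing F (l* ∷ L) P₀ P₀-nc P₀-sat P₀-avoids SC
  open Extension P (l ∷ L) P-nc (fresh-∷-nc L-nc l∉L) P-avoids
  open Override Forced forced? (forced-consistent M-nc) extend extend-var

  T : Literal → Set
  T = Holds extend

  T? : ∀ x → Dec (T x)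
  T? = holds? extend

  -- ∼ l is not forced, so the override keeps the extension's value l.
  ∼l-free : ¬ Forced (∼ l)
  ∼l-free = separated-not-forced l∉M SC-separates

  override-agrees : ∀ b → b ∈ l ∷ (l* ∷ L) → Holds override b
  override-agrees b (there b∈M) = override-forced b (inj₁ b∈M)
  override-agrees .l (here refl) with forced? l
  ... | yes r = override-forced l r
  ... | no ¬r = trans (override-free l ¬r ∼l-free) (extend-K l (here refl))

  repaired : List Clause
  repaired = filter (violated? override) F

  repaired-culprit : Culprit F (l* ∷ L) l repaired
  repaired-culprit = Restriction.violated-culprit override override-var F (l* ∷ L) l F-distinct override-agrees

  Boundary ExitSat Exit BoundaryFree FreeViolated ForcedViolated : Clause → Set
  -- leaving the forced set
  Boundary (a , b) = (Forced (∼ a) × ¬ Forced b) ⊎ (Forced (∼ b) × ¬ Forced a)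
  -- leaving the set of forced true literals
  Exit (a , b) = (Forced (∼ a) × T (∼ a) × ¬ (Forced b × T b)) ⊎ (Forced (∼ b) × T (∼ b) × ¬ (Forced a × T a))
  ExitSat (a , b) = (Forced (∼ a) × T (∼ a) × ¬ Forced b × T b) ⊎ (Forced (∼ b) × T (∼ b) × ¬ Forced a × T a)
  BoundaryFree (a , b) = (Forced (∼ a) × ¬ Forced b × ¬ Forced (∼ b) × ¬ T b) ⊎
                         (Forced (∼ b) × ¬ Forced a × ¬ Forced (∼ a) × ¬ T a)
  FreeViolated (a , b) = Violated extend (a , b) × ¬ Forced a × ¬ Forced (∼ a) × ¬ Forced b × ¬ Forced (∼ b)
  ForcedViolated (a , b) = Violated extend (a , b) × (Forced (∼ a) ⊎ Forced (∼ b))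

  Boundary? : ∀ c → Dec (Boundary c)
  Boundary? (a , b) = (forced? (∼ a) ×-dec ¬? (forced? b)) ⊎-dec (forced? (∼ b) ×-dec ¬? (forced? a))
  Exit? : ∀ c → Dec (Exit c)
  Exit? (a , b) = (forced? (∼ a) ×-dec T? (∼ a) ×-dec ¬? (forced? b ×-dec T? b)) ⊎-dec
                  (forced? (∼ b) ×-dec T? (∼ b) ×-dec ¬? (forced? a ×-dec T? a))
  ExitSat? : ∀ c → Dec (ExitSat c)
  ExitSat? (a , b) = (forced? (∼ a) ×-dec T? (∼ a) ×-dec ¬? (forced? b) ×-dec T? b) ⊎-dec
                     (forced? (∼ b) ×-dec T? (∼ b) ×-dec ¬? (forced? a) ×-dec T? a)
  BoundaryFree? : ∀ c → Dec (BoundaryFree c)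
  BoundaryFree? (a , b) = (forced? (∼ a) ×-dec ¬? (forced? b) ×-dec ¬? (forced? (∼ b)) ×-dec ¬? (T? b)) ⊎-dec
                          (forced? (∼ b) ×-dec ¬? (forced? a) ×-dec ¬? (forced? (∼ a)) ×-dec ¬? (T? a))
  FreeViolated? : ∀ c → Dec (FreeViolated c)
  FreeViolated? (a , b) = violated? extend (a , b) ×-dec ¬? (forced? a) ×-dec ¬? (forced? (∼ a)) ×-dec
                          ¬? (forced? b) ×-dec ¬? (forced? (∼ b))
  ForcedViolated? : ∀ c → Dec (ForcedViolated c)
  ForcedViolated? (a , b) = violated? extend (a , b) ×-dec (forced? (∼ a) ⊎-dec forced? (∼ b))

  -- Every boundary clause is cut by SC, since forcing propagates along F ∖ SC.
  boundary-in-SC : ∀ c → c ∈ F → Boundary c → c ∈c SC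
  boundary-in-SC c c∈F boundary with c ∈c? SC
  ... | yes c∈SC = c∈SC
  ... | no c∉SC with boundary
  ...   | inj₁ (r , ¬r) = ⊥-elim (¬r (forced-closed (∖-member⁺ F SC c∈F c∉SC) r))
  ...   | inj₂ (r , ¬r) = ⊥-elim (¬r (forced-closed (swap-∈c (∖-member⁺ F SC c∈F c∉SC)) r))

  violated-in-S : ∀ c → c ∈ F → Violated extend c → c ∈c S
  violated-in-S c c∈F (¬t₁ , ¬t₂) with c ∈c? S
  ... | yes c∈S = c∈S
  ... | no c∉S with satisfies-∈c P-sat (∖-member⁺ F S c∈F c∉S)
  ...   | inj₁ t = ⊥-elim (¬t₁ (extend-P _ t))
  ...   | inj₂ t = ⊥-elim (¬t₂ (extend-P _ t))

  exits : List Clause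
  exits = filter Exit? F

  exit-resp : ∀ {e d} → e ≈c d → Exit e → Exit d
  exit-resp (inj₁ refl) x = x
  exit-resp (inj₂ refl) (inj₁ x) = inj₂ x
  exit-resp (inj₂ refl) (inj₂ x) = inj₁ x

  -- The invariant carried along walks avoiding the exits.
  ForcedTrue : Literal → Set
  ForcedTrue x = Forced x × T x

  forced-true-step : ∀ {e} → e ∈c (F ∖ exits) → ForcedTrue (∼ proj₁ e) → ForcedTrue (proj₂ e)
  forced-true-step {e} e∈ (r , t) with forced? (proj₂ e) ×-dec T? (proj₂ e)
  ... | yes ft = ft
  ... | no ¬ft with find (proj₁ (∖-member⁻ F exits e∈))
  ...   | d , d∈ , e≈d =
    ⊥-elim (proj₂ (∖-member⁻ F exits e∈) (lose (∈-filter⁺ Exit? d∈ (exit-resp e≈d (inj₁ (r , t , ¬ft)))) e≈d))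

  forced-true-walk : ∀ c cs → All (_∈c (F ∖ exits)) (c ∷ cs) → Chain (c ∷ cs) →
                     ForcedTrue (∼ proj₁ c) → ForcedTrue (lastSecond c cs)
  forced-true-walk c [] (e∈ ∷ []) one ft = forced-true-step e∈ ft
  forced-true-walk c (c' ∷ cs) (e∈ ∷ rest) (more joint ch) ft with forced-true-step e∈ ft
  ... | r , t = forced-true-walk c' cs rest ch (subst Forced joint r , subst T joint t)

  -- The exits separate ¬L from ∼ l: a path would carry "forced and true" from L to ∼ l.
  exits-separate : Separator F (negSet L) (∼ l) exits
  exits-separate =
    All.tabulate (λ c∈ → ∈⇒∈c (proj₁ (∈-filter⁻ Exit? c∈))) ,
    filter⁺ Exit? F-distinct ,
    λ { (_ , [] , _ , (() , _))
      ; (u , c ∷ cs , u∈ , ((entries , ch , refl , last) , _)) → no-path c cs u∈ entries ch last }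
    where
    no-path : ∀ c cs → proj₁ c ∈ negSet L → All (_∈c (F ∖ exits)) (c ∷ cs) → Chain (c ∷ cs) →
              lastSecond c cs ≡ ∼ l → ⊥
    no-path c cs u∈ entries ch last with ∈-map⁻ ∼_ u∈
    ... | s , s∈L , first with forced-true-walk c cs entries ch
           (subst ForcedTrue (sym (trans (cong ∼_ first) (∼-involutive s)))
             (inj₁ (there s∈L) , extend-K s (there s∈L)))
    ...   | r , _ = ∼l-free (subst Forced last r)

  exit-cases : ∀ c → c ∈ F → Exit c → ExitSat c ⊎ ForcedViolated c
  exit-cases (a , b) _ (inj₁ (r , t , ¬ft)) with T? b
  ... | yes tb = inj₁ (inj₁ (r , t , (λ rb → ¬ft (rb , tb)) , tb))
  ... | no ¬tb = inj₂ ((holds-∼ extend a t , ¬tb) , inj₁ r)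
  exit-cases (a , b) _ (inj₂ (r , t , ¬ft)) with T? a
  ... | yes ta = inj₁ (inj₂ (r , t , (λ ra → ¬ft (ra , ta)) , ta))
  ... | no ¬ta = inj₂ ((¬ta , holds-∼ extend b t) , inj₂ r)

  exitSat-boundaryFree-disjoint : ∀ c → c ∈ F → ExitSat c → ¬ BoundaryFree c
  exitSat-boundaryFree-disjoint _ _ (inj₁ (_ , _ , _ , tb)) (inj₁ (_ , _ , _ , ¬tb)) = ¬tb tb
  exitSat-boundaryFree-disjoint _ c∈ (inj₁ (r , _ , _ , _)) (inj₂ (r' , _ , _ , _)) = clause-not-refuted (∈⇒∈c c∈) r r'
  exitSat-boundaryFree-disjoint _ c∈ (inj₂ (r' , _ , _ , _)) (inj₁ (r , _ , _ , _)) = clause-not-refuted (∈⇒∈c c∈) r r'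
  exitSat-boundaryFree-disjoint _ _ (inj₂ (_ , _ , _ , ta)) (inj₂ (_ , _ , _ , ¬ta)) = ¬ta ta

  exitSat-boundaryFree-boundary : ∀ c → c ∈ F → ExitSat c ⊎ BoundaryFree c → Boundary c
  exitSat-boundaryFree-boundary _ _ (inj₁ (inj₁ (r , _ , ¬r , _))) = inj₁ (r , ¬r)
  exitSat-boundaryFree-boundary _ _ (inj₁ (inj₂ (r , _ , ¬r , _))) = inj₂ (r , ¬r)
  exitSat-boundaryFree-boundary _ _ (inj₂ (inj₁ (r , ¬r , _))) = inj₁ (r , ¬r)
  exitSat-boundaryFree-boundary _ _ (inj₂ (inj₂ (r , ¬r , _))) = inj₂ (r , ¬r)

  ¬T : ∀ x → ¬ Forced x → ¬ Forced (∼ x) → ¬ Holds override x → ¬ T x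
  ¬T x ¬r ¬r' ¬q t = ¬q (trans (override-free x ¬r ¬r') t)

  repaired-cases : ∀ c → c ∈ F → Violated override c → BoundaryFree c ⊎ FreeViolated c
  repaired-cases (a , b) c∈ (¬qa , ¬qb) with forced? a | forced? b
  ... | yes ra | _ = ⊥-elim (¬qa (override-forced a ra))
  ... | no _ | yes rb = ⊥-elim (¬qb (override-forced b rb))
  ... | no ¬ra | no ¬rb with forced? (∼ a) | forced? (∼ b)
  ...   | yes r₁ | yes r₂ = ⊥-elim (clause-not-refuted (∈⇒∈c c∈) r₁ r₂)
  ...   | yes r₁ | no ¬r₂ = inj₁ (inj₁ (r₁ , ¬rb , ¬r₂ , ¬T b ¬rb ¬r₂ ¬qb))
  ...   | no ¬r₁ | yes r₂ = inj₁ (inj₂ (r₂ , ¬ra , ¬r₁ , ¬T a ¬ra ¬r₁ ¬qa))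
  ...   | no ¬r₁ | no ¬r₂ = inj₂ ((¬T a ¬ra ¬r₁ ¬qa , ¬T b ¬rb ¬r₂ ¬qb) , ¬ra , ¬r₁ , ¬rb , ¬r₂)

  freeViolated-forcedViolated-disjoint : ∀ c → c ∈ F → FreeViolated c → ¬ ForcedViolated c
  freeViolated-forcedViolated-disjoint _ _ (_ , _ , ¬r₁ , _ , _) (_ , inj₁ r₁) = ¬r₁ r₁
  freeViolated-forcedViolated-disjoint _ _ (_ , _ , _ , _ , ¬r₂) (_ , inj₂ r₂) = ¬r₂ r₂

  freeViolated-forcedViolated-violated : ∀ c → c ∈ F → FreeViolated c ⊎ ForcedViolated c → Violated extend c
  freeViolated-forcedViolated-violated _ _ (inj₁ (v , _)) = v
  freeViolated-forcedViolated-violated _ _ (inj₂ (v , _)) = v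

  open ≤-Reasoning

  boundaryFree≤forcedViolated : (∀ SC' → Separator F (negSet L) (∼ l) SC' → length SC ≤ length SC') →
                                count BoundaryFree? F ≤ count ForcedViolated? F
  boundaryFree≤forcedViolated SC-minimal = +-cancelˡ-≤ (count ExitSat? F) _ _ (begin
    count ExitSat? F + count BoundaryFree? F
      ≤⟨ count-disjoint ExitSat? BoundaryFree? Boundary? F exitSat-boundaryFree-disjoint exitSat-boundaryFree-boundary ⟩
    count Boundary? F      ≤⟨ count-≤-length Boundary? F-distinct boundary-in-SC ⟩
    length SC              ≤⟨ SC-minimal exits exits-separate ⟩
    count Exit? F          ≤⟨ count-union Exit? ExitSat? ForcedViolated? F exit-cases ⟩
    count ExitSat? F + count ForcedViolated? F ∎)

  exchange : (∀ SC' → Separator F (negSet L) (∼ l) SC' → length SC ≤ length SC') → length repaired ≤ length S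
  exchange SC-minimal = begin
    count (violated? override) F
      ≤⟨ count-union (violated? override) BoundaryFree? FreeViolated? F repaired-cases ⟩
    count BoundaryFree? F + count FreeViolated? F
      ≤⟨ +-monoˡ-≤ _ (boundaryFree≤forcedViolated SC-minimal) ⟩
    count ForcedViolated? F + count FreeViolated? F
      ≡⟨ +-comm (count ForcedViolated? F) (count FreeViolated? F) ⟩
    count FreeViolated? F + count ForcedViolated? F
      ≤⟨ count-disjoint FreeViolated? ForcedViolated? (violated? extend) F
           freeViolated-forcedViolated-disjoint freeViolated-forcedViolated-violated ⟩
    count (violated? extend) F
      ≤⟨ count-≤-length (violated? extend) F-distinct violated-in-S ⟩
    length S ∎

theorem3 : (F : Formula) (L : List Literal) (l l* : Literal) →
    Instance F L l → Neutral F L l l* →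
    (k : ℕ) → MinCulpritSize F L l k →
    ∃[ S ] (Culprit F (l* ∷ L) l S × length S ≤ k)
theorem3 F L l l* (F-distinct , L-nc , _ , l∉L)
  ((_ , M-nc , (P₀ , (P₀-nc , _ , P₀-sat) , P₀-avoids) , l∉M) ,
   _ , (_ , L-minimal) , ((SC , (_ , _ , SC-separates) , SC-size) , _))
  k ((S , (_ , _ , (P , (P-nc , _ , P-sat) , P-avoids)) , S-size) , _) =
  repaired , repaired-culprit , subst (length repaired ≤_) S-size (exchange SC-minimal)
  where
  open Exchange F L l l* F-distinct L-nc l∉L M-nc l∉M P₀ P₀-nc P₀-sat P₀-avoids
                SC SC-separates S P P-nc P-sat P-avoids

  SC-minimal : ∀ SC' → Separator F (negSet L) (∼ l) SC' → length SC ≤ length SC'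
  SC-minimal SC' separates = subst (_≤ length SC') (sym SC-size) (L-minimal SC' separates)
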